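{- For every integer $k\ge 3$ there exist $\eta=\eta(k)>0$ and $n_0=n_0(k)$ such that for every $n\ge n_0$ there exists a digraph $G$ on $n$ vertices whose outdegree sequence $d^+_1\le\dots\le d^+_n$ and indegree sequence $d^-_1\le\dots\le d^-_n$ satisfy $d^+_i\ge i+\eta n$ and $d^-_i\ge i+\eta n$ for all $i<n/2$, but such that some vertex of $G$ does not lie on any directed cycle of length less than $k$.
   Context: Digraphs have no loops and at most one edge in each direction between any pair of vertices. The out- and indegree sequences are each sorted in non-decreasing order separately. -}

module Defs where

open import Data.Nat using (ℕ; zero; suc; _≤_; _<_; _*_)
open import Data.Nat.Properties using (≤-decTotalOrder)
open import Data.Bool using (Bool; true; false)
open import Data.Fin using (Fin; toℕ)
open import Data.List using (List; length; map; filter; lookup)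
open import Data.List.Base using (allFin)
open import Data.Integer using (+_)
open import Data.Rational using (ℚ; _/_)
open import Data.Product using (Σ; ∃; _×_)
open import Data.Sum using (_⊎_)
open import Function.Definitions using (Injective)
open import Relation.Binary.PropositionalEquality using (_≡_)
open import Relation.Nullary using (¬_)
open import Data.Bool.Properties using (T?)
open import Data.Bool using (T)
import Data.List.Sort.InsertionSort as IS

-- A digraph on vertex set Fin n: an adjacency relation (Bool-valued,
-- so at most one edge u → v for each ordered pair) with no loops.
record Digraph (n : ℕ) : Set where
  field
    adj      : Fin n → Fin n → Bool
    loopless : ∀ v → adj v v ≡ false
open Digraph public

module _ {n : ℕ} (G : Digraph n) where

  outdeg : Fin n → ℕ
  outdeg v = length (filter (λ w → T? (adj G v w)) (allFin n))

  indeg : Fin n → ℕ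
  indeg v = length (filter (λ u → T? (adj G u v)) (allFin n))

  outdegSeq : List ℕ
  outdegSeq = IS.sort ≤-decTotalOrder (map outdeg (allFin n))

  indegSeq : List ℕ
  indegSeq = IS.sort ≤-decTotalOrder (map indeg (allFin n))

  record DirectedCycleThrough (v : Fin n) (ℓ : ℕ) : Set where
    field
      atLeast2 : 2 ≤ ℓ
      c        : Fin ℓ → Fin n
      distinct : Injective _≡_ _≡_ c
      edges    : ∀ (i j : Fin ℓ) →
                 (suc (toℕ i) ≡ toℕ j ⊎ (suc (toℕ i) ≡ ℓ × toℕ j ≡ 0)) →
                 adj G (c i) (c j) ≡ true
      through  : ∃ λ i → c i ≡ v

ℕ→ℚ : ℕ → ℚ
ℕ→ℚ m = (+ m) / 1

module Submission where

open import Defs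
open import Data.Nat using (ℕ; suc; _≤_; _<_; _*_)
open import Data.Fin using (Fin; toℕ)
open import Data.List using (lookup; length)
open import Data.Rational using (ℚ; Positive) renaming (_≤_ to _≤ℚ_; _+_ to _+ℚ_; _*_ to _*ℚ_)
open import Data.Product using (Σ; ∃; _×_)
open import Relation.Nullary using (¬_)

open import Data.Nat using (zero; pred; _+_; _∸_; _⊓_; z≤n; s≤s; s≤s⁻¹; _≟_; _≤?_; _≤ᵇ_)
open import Data.Nat.Properties
open import Data.Nat.DivMod using (_%_; _mod_; n%n≡0; m<n⇒m%n≡m)
open import Data.Nat.Tactic.RingSolver using (solve-∀)
open import Algebra.Properties.CommutativeSemigroup +-commutativeSemigroup
  using () renaming (xy∙z≈xz∙y to +-swapʳ)
open import Data.Bool using (Bool; true; false; T)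
open import Data.Bool.Properties using (T?)
open import Data.Fin using () renaming (zero to fzero; suc to fsuc)
open import Data.Fin.Properties using (toℕ<n; toℕ-fromℕ<; toℕ-injective)
open import Data.List using (List; []; _∷_; filter; tabulate; reverse; _∷ʳ_)
open import Data.List.Properties using (length-reverse; length-tabulate; unfold-reverse; map-tabulate)
open import Data.List.Relation.Binary.Permutation.Propositional
  using (_↭_; ↭-reflexive; ↭-trans; ↭-sym; prep; ↭⇒↭ₛ)
open import Data.List.Relation.Binary.Permutation.Propositional.Properties using (↭-reverse)
open import Data.List.Relation.Binary.Pointwise using (Pointwise-≡⇒≡)
open import Data.List.Relation.Unary.Sorted.TotalOrder.Properties using (↗↭↗⇒≋)
import Data.List.Sort.InsertionSort as InsertionSort
import Data.List.Sort.InsertionSort.Properties as InsertionSortₚ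
open import Data.Product using (_,_; proj₁; proj₂)
open import Data.Sum using (_⊎_; inj₁; inj₂)
open import Data.Unit using (⊤; tt)
open import Function using (_∘_)
open import Relation.Binary.PropositionalEquality
open import Relation.Nullary using (Dec; does; ¬?; contradiction)
open import Relation.Nullary.Decidable using (_×-dec_; dec-true; dec-false; decidable-stable)

-- Put the vertices 0, …, n-1 at heights 0, …, n-1 and fix a step
-- d = ⌊n / k⌋.  There is an arc u → w (u ≠ w) iff w rises at most d above u,
-- where vertex 0, as the head of an arc, counts as height n: every vertex may
-- step down arbitrarily, up by at most d, and into 0 only from the top d levels.
--   * Cycles.  Going once around a cycle through 0 the heights must climb n in
--     total while every arc climbs at most d, so such a cycle has length ≥ n / d ≥ k.  Vertex u has out-degree ≥ reach u ∸ 1 with reach u = (u + d) ⊓ (n-1);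
--     vertex w ≠ 0 has in-degree at least the same bound taken at position n ∸ w,
--     and vertex 0 has in-degree ≥ d.  Counting in windows gives these (Counting),
--     and a general fact about insertion sort transfers termwise lower bounds by a
--     monotone function to the sorted sequence (Sorting).
--   * Arithmetic.  For the i-th entry with 2i < n the bound is i + (d ∸ 2), and
--     n ≤ (4k+1)(d ∸ 2) once n ≥ 3k, so η = 1/(4k+1) works (RationalBound).

module Counting where

  indicator : Bool → ℕ
  indicator true  = 1
  indicator false = 0

  count : ∀ {k} → (Fin k → Bool) → ℕ
  count {zero}  p = 0
  count {suc k} p = indicator (p fzero) + count (p ∘ fsuc)

  length-filter-tabulate : ∀ {A : Set} {k} (P : A → Bool) (g : Fin k → A) →
    length (filter (λ x → T? (P x)) (tabulate g)) ≡ count (P ∘ g)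
  length-filter-tabulate {k = zero}  P g = refl
  length-filter-tabulate {k = suc k} P g with P (g fzero)
  ... | true  = cong suc (length-filter-tabulate P (g ∘ fsuc))
  ... | false = length-filter-tabulate P (g ∘ fsuc)

  window : ∀ k (q : ℕ → Bool) lo r → lo + r ≤ k →
    (∀ i → lo ≤ i → i < lo + r → q i ≡ true) → r ≤ count {k} (q ∘ toℕ)
  window k       q lo       zero    _        _ = z≤n
  window (suc k) q zero     (suc r) (s≤s le) H rewrite H 0 z≤n (s≤s z≤n) =
    s≤s (window k (q ∘ suc) zero r le (λ i _ i<r → H (suc i) z≤n (s≤s i<r)))
  window (suc k) q (suc lo) r       (s≤s le) H =
    ≤-trans (window k (q ∘ suc) lo r le (λ i lo≤i i< → H (suc i) (s≤s lo≤i) (s≤s i<)))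
            (m≤n+m _ (indicator (q 0)))

  window-with-hole : ∀ k (q : ℕ → Bool) lo r e → lo + r ≤ k →
    (∀ i → lo ≤ i → i < lo + r → i ≢ e → q i ≡ true) → r ≤ suc (count {k} (q ∘ toℕ))
  window-with-hole k       q lo       zero    e       _        _ = z≤n
  window-with-hole (suc k) q zero     (suc r) zero    (s≤s le) H =
    s≤s (≤-trans (window k (q ∘ suc) zero r le (λ i _ i<r → H (suc i) z≤n (s≤s i<r) λ ()))
                 (m≤n+m _ (indicator (q 0))))
  window-with-hole (suc k) q zero     (suc r) (suc e) (s≤s le) H
    rewrite H 0 z≤n (s≤s z≤n) (λ ()) =
    s≤s (window-with-hole k (q ∘ suc) zero r e le
          (λ i _ i<r i≢e → H (suc i) z≤n (s≤s i<r) (i≢e ∘ suc-injective)))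
  window-with-hole (suc k) q (suc lo) r       e       (s≤s le) H =
    ≤-trans (window-with-hole k (q ∘ suc) lo r (pred e) le
              (λ i lo≤i i< i≢ → H (suc i) (s≤s lo≤i) (s≤s i<) λ { refl → i≢ refl }))
            (s≤s (m≤n+m _ (indicator (q 0))))

module Sorting where

  sort : List ℕ → List ℕ
  sort = InsertionSort.sort ≤-decTotalOrder

  sort-↭ : ∀ {xs ys} → xs ↭ ys → sort xs ≡ sort ys
  sort-↭ {xs} {ys} xs↭ys = Pointwise-≡⇒≡ (↗↭↗⇒≋ ≤-totalOrder (sort-↗ xs) (sort-↗ ys)
    (↭⇒↭ₛ (↭-trans (sort-rearranges xs) (↭-trans xs↭ys (↭-sym (sort-rearranges ys))))))
    where open InsertionSortₚ ≤-decTotalOrder using (sort-↗) renaming (sort-↭ to sort-rearranges)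

  Monotone : (ℕ → ℕ) → Set
  Monotone h = ∀ i → h i ≤ h (suc i)

  Above : (ℕ → ℕ) → List ℕ → Set
  Above h []       = ⊤
  Above h (x ∷ xs) = h 0 ≤ x × Above (h ∘ suc) xs

  Above-lookup : ∀ h xs → Above h xs → ∀ j → h (toℕ j) ≤ lookup xs j
  Above-lookup h (x ∷ xs) (hx , _)   fzero    = hx
  Above-lookup h (x ∷ xs) (_  , hxs) (fsuc j) = Above-lookup (h ∘ suc) xs hxs j

  -- inserting x, which dominates the front position, keeps a termwise lower bound:
  -- an entry pushed one place back still dominates, as h is monotone
  insert-Above : ∀ h → Monotone h → ∀ x ys → h 0 ≤ x → Above (h ∘ suc) ys →
    Above h (InsertionSort.insert ≤-decTotalOrder x ys)
  insert-Above h h↑ x []       hx _          = hx , tt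
  insert-Above h h↑ x (y ∷ ys) hx (hy , hys) with x ≤ᵇ y in x≤ᵇy
  ... | true  = hx , hy , hys
  ... | false = ≤-trans (h↑ 0) hy
              , insert-Above (h ∘ suc) (h↑ ∘ suc) x ys (≤-trans hy (<⇒≤ y<x)) hys
    where
    y<x : y < x
    y<x = ≰⇒> λ x≤y → subst T x≤ᵇy (≤⇒≤ᵇ x≤y)

  sort-Above : ∀ h → Monotone h → ∀ xs → Above h xs → Above h (sort xs)
  sort-Above h h↑ []       _          = tt
  sort-Above h h↑ (x ∷ xs) (hx , hxs) =
    insert-Above h h↑ x (sort xs) hx (sort-Above (h ∘ suc) (h↑ ∘ suc) xs hxs)

  sorted-lower-bound : ∀ h → Monotone h → ∀ {xs} ys → xs ↭ ys → Above h ys →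
    ∀ j → h (toℕ j) ≤ lookup (sort xs) j
  sorted-lower-bound h h↑ {xs} ys xs↭ys above =
    Above-lookup h (sort xs) (subst (Above h) (sym (sort-↭ xs↭ys)) (sort-Above h h↑ ys above))

  Above-tabulate : ∀ h {k} (g : Fin k → ℕ) → (∀ i → h (toℕ i) ≤ g i) → Above h (tabulate g)
  Above-tabulate h {zero}  g H = tt
  Above-tabulate h {suc k} g H = H fzero , Above-tabulate (h ∘ suc) (g ∘ fsuc) (H ∘ fsuc)

  Above-∷ʳ : ∀ h xs x → Above h xs → h (length xs) ≤ x → Above h (xs ∷ʳ x)
  Above-∷ʳ h []       x _          hx = hx , tt
  Above-∷ʳ h (y ∷ ys) x (hy , hys) hx = hy , Above-∷ʳ (h ∘ suc) ys x hys hx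

  -- in reverse (tabulate g) the entry g i sits at position k ∸ suc i
  Above-reverse-tabulate : ∀ h {k} (g : Fin k → ℕ) →
    (∀ i → h (k ∸ suc (toℕ i)) ≤ g i) → Above h (reverse (tabulate g))
  Above-reverse-tabulate h {zero}  g H = tt
  Above-reverse-tabulate h {suc k} g H =
    subst (Above h) (sym (unfold-reverse (g fzero) rest))
      (Above-∷ʳ h (reverse rest) (g fzero)
        (Above-reverse-tabulate h (g ∘ fsuc) (H ∘ fsuc))
        (subst (λ p → h p ≤ g fzero) (sym length-rest) (H fzero)))
    where
    rest : List ℕ
    rest = tabulate (g ∘ fsuc)
    length-rest : length (reverse rest) ≡ k
    length-rest = trans (length-reverse rest) (length-tabulate (g ∘ fsuc))

open Counting
open Sorting

module Sums where

  ∑< : ℕ → (ℕ → ℕ) → ℕ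
  ∑< zero    f = 0
  ∑< (suc ℓ) f = ∑< ℓ f + f ℓ

  ∑<-shift : ∀ ℓ f → ∑< ℓ (f ∘ suc) + f 0 ≡ ∑< ℓ f + f ℓ
  ∑<-shift zero    f = refl
  ∑<-shift (suc ℓ) f = begin
    ∑< ℓ (f ∘ suc) + f (suc ℓ) + f 0   ≡⟨ +-swapʳ (∑< ℓ (f ∘ suc)) (f (suc ℓ)) (f 0) ⟩
    ∑< ℓ (f ∘ suc) + f 0 + f (suc ℓ)   ≡⟨ cong (_+ f (suc ℓ)) (∑<-shift ℓ f) ⟩
    ∑< ℓ f + f ℓ + f (suc ℓ)           ∎
    where open ≡-Reasoning

  ∑<-mono : ∀ ℓ f g → (∀ t → t < ℓ → f t ≤ g t) → ∑< ℓ f ≤ ∑< ℓ g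
  ∑<-mono zero    f g H = z≤n
  ∑<-mono (suc ℓ) f g H =
    +-mono-≤ (∑<-mono ℓ f g (λ t t<ℓ → H t (m≤n⇒m≤1+n t<ℓ))) (H ℓ ≤-refl)

  ∑<-bound : ∀ ℓ f g d → (∀ t → t < ℓ → f t ≤ g t + d) → ∑< ℓ f ≤ ∑< ℓ g + ℓ * d
  ∑<-bound zero    f g d H = z≤n
  ∑<-bound (suc ℓ) f g d H = begin
    ∑< ℓ f + f ℓ                ≤⟨ +-mono-≤ (∑<-bound ℓ f g d H-below) (H ℓ ≤-refl) ⟩
    ∑< ℓ g + ℓ * d + (g ℓ + d)  ≡⟨ regroup (∑< ℓ g) (g ℓ) ℓ d ⟩
    ∑< ℓ g + g ℓ + suc ℓ * d    ∎
    where
    open ≤-Reasoning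
    H-below : ∀ t → t < ℓ → f t ≤ g t + d
    H-below t t<ℓ = H t (m≤n⇒m≤1+n t<ℓ)
    regroup : ∀ s x ℓ d → s + ℓ * d + (x + d) ≡ s + x + suc ℓ * d
    regroup = solve-∀

  ∑<-gap : ∀ ℓ f g n t₀ → (∀ t → t < ℓ → f t ≤ g t) → t₀ < ℓ → f t₀ + n ≤ g t₀ →
    ∑< ℓ f + n ≤ ∑< ℓ g
  ∑<-gap (suc ℓ) f g n t₀ H t₀<ℓ gap with m≤n⇒m<n∨m≡n (s≤s⁻¹ t₀<ℓ)
  ... | inj₁ t₀<ℓ′ = begin
    ∑< ℓ f + f ℓ + n     ≡⟨ +-swapʳ (∑< ℓ f) (f ℓ) n ⟩
    ∑< ℓ f + n + f ℓ     ≤⟨ +-mono-≤ (∑<-gap ℓ f g n t₀ H-below t₀<ℓ′ gap) (H ℓ ≤-refl) ⟩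
    ∑< ℓ g + g ℓ         ∎
    where
    open ≤-Reasoning
    H-below : ∀ t → t < ℓ → f t ≤ g t
    H-below t t<ℓ = H t (m≤n⇒m≤1+n t<ℓ)
  ... | inj₂ refl = begin
    ∑< ℓ f + f t₀ + n    ≡⟨ +-assoc (∑< ℓ f) (f t₀) n ⟩
    ∑< ℓ f + (f t₀ + n)  ≤⟨ +-mono-≤ (∑<-mono ℓ f g H-below) gap ⟩
    ∑< ℓ g + g t₀        ∎
    where
    open ≤-Reasoning
    H-below : ∀ t → t < ℓ → f t ≤ g t
    H-below t t<ℓ = H t (m≤n⇒m≤1+n t<ℓ)

module Construction (m d : ℕ) where

  open Sums

  n : ℕ
  n = suc m

  -- the height at which an arc arrives at w: vertex 0 is entered from the top, at height n
  arrival : ℕ → ℕ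
  arrival zero    = n
  arrival (suc w) = suc w

  arrival-≥ : ∀ w → w ≤ arrival w
  arrival-≥ zero    = z≤n
  arrival-≥ (suc w) = ≤-refl

  arrival-≤ : ∀ {w} → w < n → arrival w ≤ n
  arrival-≤ {zero}  _   = ≤-refl
  arrival-≤ {suc w} w<n = <⇒≤ w<n

  Arc : ℕ → ℕ → Set
  Arc u w = u ≢ w × arrival w ≤ u + d

  Arc? : ∀ u w → Dec (Arc u w)
  Arc? u w = ¬? (u ≟ w) ×-dec (arrival w ≤? u + d)

  arc : ℕ → ℕ → Bool
  arc u w = does (Arc? u w)

  arc-intro : ∀ {u w} → u ≢ w → arrival w ≤ u + d → arc u w ≡ true
  arc-intro {u} {w} u≢w rise = dec-true (Arc? u w) (u≢w , rise)

  arc-rise : ∀ {u w} → arc u w ≡ true → arrival w ≤ u + d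
  arc-rise {u} {w} is-arc = decidable-stable (arrival w ≤? u + d) λ no-rise →
    contradiction (trans (sym is-arc) (dec-false (Arc? u w) (no-rise ∘ proj₂))) λ ()

  G : Digraph n
  G = record
    { adj      = λ u w → arc (toℕ u) (toℕ w)
    ; loopless = λ v → dec-false (Arc? (toℕ v) (toℕ v)) (λ (v≢v , _) → v≢v refl)
    }

  -- the highest nonzero height vertex u can step to
  reach : ℕ → ℕ
  reach u = (u + d) ⊓ m

  -- u reaches every height 1, …, reach u except its own
  outdeg-bound : ∀ u → reach (toℕ u) ≤ suc (outdeg G u)
  outdeg-bound u =
    subst (λ deg → reach a ≤ suc deg) (sym (length-filter-tabulate (adj G u) (λ w → w)))
      (window-with-hole n (arc a) 1 (reach a) a (s≤s (m⊓n≤n _ m)) successor)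
    where
    a : ℕ
    a = toℕ u
    successor : ∀ i → 1 ≤ i → i < 1 + reach a → i ≢ a → arc a i ≡ true
    successor (suc i) _ (s≤s i≤reach) i≢a = arc-intro (i≢a ∘ sym) (≤-trans i≤reach (m⊓n≤m _ m))

  -- every vertex at height ≥ arrival w ∸ d, other than w, steps to w
  indeg-bound : ∀ w → n ∸ (arrival (toℕ w) ∸ d) ≤ suc (indeg G w)
  indeg-bound w =
    subst (λ deg → n ∸ lo ≤ suc deg) (sym (length-filter-tabulate (λ u → adj G u w) (λ u → u)))
      (window-with-hole n (λ u → arc u b) lo (n ∸ lo) b (≤-reflexive (m+[n∸m]≡n lo≤n)) predecessor)
    where
    b lo : ℕ
    b  = toℕ w
    lo = arrival b ∸ d
    lo≤n : lo ≤ n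
    lo≤n = ≤-trans (m∸n≤m (arrival b) d) (arrival-≤ (toℕ<n w))
    predecessor : ∀ i → lo ≤ i → i < lo + (n ∸ lo) → i ≢ b → arc i b ≡ true
    predecessor i lo≤i _ i≢b = arc-intro i≢b (begin
      arrival b        ≤⟨ m≤n+m∸n (arrival b) d ⟩
      d + lo           ≤⟨ +-monoʳ-≤ d lo≤i ⟩
      d + i            ≡⟨ +-comm d i ⟩
      i + d            ∎)
      where open ≤-Reasoning

  bound : ℕ → ℕ
  bound p = reach p ∸ 1

  bound-monotone : Monotone bound
  bound-monotone p = ∸-monoˡ-≤ 1 (⊓-monoˡ-≤ m (+-monoˡ-≤ d (n≤1+n p)))

  outdegSeq-bound : ∀ j → bound (toℕ j) ≤ lookup (outdegSeq G) j
  outdegSeq-bound = sorted-lower-bound bound bound-monotone (tabulate (outdeg G))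
    (↭-reflexive (map-tabulate (λ u → u) (outdeg G)))
    (Above-tabulate bound (outdeg G) (λ u → ∸-monoˡ-≤ 1 (outdeg-bound u)))

  -- in-degrees decrease with the height of a nonzero vertex, so the vertex at
  -- height a ≠ 0 belongs at position n ∸ a; the numbers match the reach at that position
  reach-complement : ∀ a → a ≤ n → reach (n ∸ a) ≤ n ∸ (a ∸ d)
  reach-complement a a≤n with ≤-total d a
  ... | inj₁ d≤a = ≤-trans (m⊓n≤m _ m) (≤-reflexive (sym (begin
    n ∸ (a ∸ d)                ≡⟨ cong (_∸ (a ∸ d)) (sym (m∸n+n≡m a≤n)) ⟩
    (n ∸ a) + a ∸ (a ∸ d)      ≡⟨ +-∸-assoc (n ∸ a) (m∸n≤m a d) ⟩
    (n ∸ a) + (a ∸ (a ∸ d))    ≡⟨ cong ((n ∸ a) +_) (m∸[m∸n]≡n d≤a) ⟩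
    (n ∸ a) + d                ∎)))
    where open ≡-Reasoning
  ... | inj₂ a≤d = subst (reach (n ∸ a) ≤_) (cong (n ∸_) (sym (m≤n⇒m∸n≡0 a≤d)))
                         (≤-trans (m⊓n≤n _ m) (n≤1+n m))

  indeg-bound-at : ∀ w → bound (n ∸ arrival (toℕ w)) ≤ indeg G w
  indeg-bound-at w = ∸-monoˡ-≤ 1 (≤-trans (reach-complement _ (arrival-≤ (toℕ<n w))) (indeg-bound w))

  indegSeq-bound : ∀ j → bound (toℕ j) ≤ lookup (indegSeq G) j
  indegSeq-bound = sorted-lower-bound bound bound-monotone
    (indeg G fzero ∷ reverse (tabulate (indeg G ∘ fsuc)))
    (prep (indeg G fzero)
      (↭-trans (↭-reflexive (map-tabulate fsuc (indeg G))) (↭-sym (↭-reverse _))))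
    ( subst (λ p → bound p ≤ indeg G fzero) (n∸n≡0 n) (indeg-bound-at fzero)
    , Above-reverse-tabulate (bound ∘ suc) (indeg G ∘ fsuc) (λ i →
        subst (λ p → bound p ≤ indeg G (fsuc i)) (+-∸-assoc 1 (toℕ<n i)) (indeg-bound-at (fsuc i))))

  -- Along a closed walk through vertex 0 the height must climb by n in total,
  -- but each arc climbs by at most d: so a cycle through 0 has length ≥ n / d.
  -- Formally, summing  arrival (x (t+1)) ≤ x t + d  over the cycle, the left side
  -- exceeds ∑ x by n (vertex 0 arrives at height n), the right side by ℓ · d.
  cycle-through-0 : ∀ {v L} → toℕ v ≡ 0 → DirectedCycleThrough G v (suc L) → n ≤ suc L * d
  cycle-through-0 {v} {L} v≡0 C = +-cancelˡ-≤ (∑< ℓ x) n (ℓ * d) (begin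
    ∑< ℓ x + n                   ≤⟨ ∑<-gap ℓ x (arrival ∘ x) n t₀ (λ t _ → arrival-≥ (x t))
                                      (toℕ<n i₀) climb ⟩
    ∑< ℓ (arrival ∘ x)            ≡⟨ rotate ⟨
    ∑< ℓ (arrival ∘ x ∘ suc)      ≤⟨ ∑<-bound ℓ (arrival ∘ x ∘ suc) x d
                                       (λ t t<ℓ → arc-rise (step t t<ℓ)) ⟩
    ∑< ℓ x + ℓ * d                ∎)
    where
    open DirectedCycleThrough C
    open ≤-Reasoning
    ℓ : ℕ
    ℓ = suc L

    toℕ-mod : ∀ t → toℕ (t mod ℓ) ≡ t % ℓ
    toℕ-mod t = toℕ-fromℕ< _

    x : ℕ → ℕ
    x t = toℕ (c (t mod ℓ))

    step : ∀ t → t < ℓ → arc (x t) (x (suc t)) ≡ true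
    step t t<ℓ = edges (t mod ℓ) (suc t mod ℓ) consecutive
      where
      t-mod : toℕ (t mod ℓ) ≡ t
      t-mod = trans (toℕ-mod t) (m<n⇒m%n≡m t<ℓ)
      consecutive : suc (toℕ (t mod ℓ)) ≡ toℕ (suc t mod ℓ)
                  ⊎ (suc (toℕ (t mod ℓ)) ≡ ℓ × toℕ (suc t mod ℓ) ≡ 0)
      consecutive with m≤n⇒m<n∨m≡n t<ℓ
      ... | inj₁ 1+t<ℓ =
        inj₁ (trans (cong suc t-mod) (sym (trans (toℕ-mod (suc t)) (m<n⇒m%n≡m 1+t<ℓ))))
      ... | inj₂ refl  = inj₂ (cong suc t-mod , trans (toℕ-mod ℓ) (n%n≡0 ℓ))

    rotate : ∑< ℓ (arrival ∘ x ∘ suc) ≡ ∑< ℓ (arrival ∘ x)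
    rotate = +-cancelʳ-≡ (arrival (x 0)) _ _
      (trans (∑<-shift ℓ (arrival ∘ x)) (cong (λ y → ∑< ℓ (arrival ∘ x) + arrival y) periodic))
      where
      periodic : x ℓ ≡ x 0
      periodic = cong (λ i → toℕ (c i)) (toℕ-injective (trans (toℕ-mod ℓ) (n%n≡0 ℓ)))

    i₀ : Fin ℓ
    i₀ = proj₁ through
    t₀ : ℕ
    t₀ = toℕ i₀
    x-t₀≡0 : x t₀ ≡ 0
    x-t₀≡0 = begin-equality
      toℕ (c (t₀ mod ℓ)) ≡⟨ cong (toℕ ∘ c) (toℕ-injective
                               (trans (toℕ-mod t₀) (m<n⇒m%n≡m (toℕ<n i₀)))) ⟩
      toℕ (c i₀)         ≡⟨ cong toℕ (proj₂ through) ⟩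
      toℕ v              ≡⟨ v≡0 ⟩
      0                  ∎
    climb : x t₀ + n ≤ arrival (x t₀)
    climb = subst (λ h → h + n ≤ arrival h) (sym x-t₀≡0) ≤-refl

module RationalBound where

  open import Data.Nat.Coprimality using (1-coprimeTo) renaming (sym to coprime-sym)
  open import Data.Integer as ℤ using (+_)
  import Data.Integer.Properties as ℤP
  open import Data.Rational using (_/_; toℚᵘ)
  import Data.Rational.Properties as ℚP
  open import Data.Rational.Unnormalised as ℚᵘ using (mkℚᵘ; *≤*) renaming (_≤_ to _≤ᵘ_; _≃_ to _≃ᵘ_)
  import Data.Rational.Unnormalised.Properties as ℚᵘP

  η : ℕ → ℚ
  η N = + 1 / suc N

  η-positive : ∀ N → Positive (η N)
  η-positive N = ℚP.normalize-pos 1 (suc N)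

  -- both are already in lowest terms, so their unnormalised forms are the obvious ones
  ℕ→ℚ-unnormalised : ∀ a → toℚᵘ (ℕ→ℚ a) ≡ mkℚᵘ (+ a) 0
  ℕ→ℚ-unnormalised a = cong toℚᵘ (ℚP.normalize-coprime (coprime-sym (1-coprimeTo a)))

  η-unnormalised : ∀ N → toℚᵘ (η N) ≡ mkℚᵘ (+ 1) N
  η-unnormalised N = cong toℚᵘ (ℚP.normalize-coprime (1-coprimeTo (suc N)))

  η-bound : ∀ N a n c L → n ≤ suc N * c → a + c ≤ L → ℕ→ℚ a +ℚ η N *ℚ ℕ→ℚ n ≤ℚ ℕ→ℚ L
  η-bound N a n c L n≤Nc a+c≤L = ℚP.toℚᵘ-cancel-≤
    (ℚᵘP.≤-respˡ-≃ (ℚᵘP.≃-sym unnormalise)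
      (subst (_ ≤ᵘ_) (sym (ℕ→ℚ-unnormalised L)) (*≤* cross-multiplied)))
    where
    unnormalise : toℚᵘ (ℕ→ℚ a +ℚ η N *ℚ ℕ→ℚ n)
                  ≃ᵘ mkℚᵘ (+ a) 0 ℚᵘ.+ mkℚᵘ (+ 1) N ℚᵘ.* mkℚᵘ (+ n) 0
    unnormalise = ℚᵘP.≃-trans (ℚP.toℚᵘ-homo-+ (ℕ→ℚ a) (η N *ℚ ℕ→ℚ n))
      (ℚᵘP.≃-trans (ℚᵘP.+-congʳ (toℚᵘ (ℕ→ℚ a)) (ℚP.toℚᵘ-homo-* (η N) (ℕ→ℚ n)))
        (ℚᵘP.≃-reflexive (cong₂ ℚᵘ._+_ (ℕ→ℚ-unnormalised a)
                                        (cong₂ ℚᵘ._*_ (η-unnormalised N) (ℕ→ℚ-unnormalised n)))))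
    cross-multipliedℕ : a * suc N + n ≤ L * suc N
    cross-multipliedℕ = begin
      a * suc N + n          ≤⟨ +-monoʳ-≤ (a * suc N) n≤Nc ⟩
      a * suc N + suc N * c  ≡⟨ cong (λ z → a * suc N + z) (*-comm (suc N) c) ⟩
      a * suc N + c * suc N  ≡⟨ *-distribʳ-+ (suc N) a c ⟨
      (a + c) * suc N        ≤⟨ *-monoˡ-≤ (suc N) a+c≤L ⟩
      L * suc N              ∎
      where open ≤-Reasoning
    -- the same inequality as it appears after unfolding the unnormalised operations
    cross-multiplied : (+ a ℤ.* + suc (N * 1) ℤ.+ (+ 1 ℤ.* + n) ℤ.* + 1) ℤ.* + 1
                       ℤ.≤ + L ℤ.* + suc (N * 1 + 0)
    cross-multiplied
      rewrite *-identityʳ N | +-identityʳ N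
            | ℤP.*-identityʳ (+ a ℤ.* + suc N ℤ.+ (+ 1 ℤ.* + n) ℤ.* + 1)
            | ℤP.*-identityʳ (+ 1 ℤ.* + n) | ℤP.*-identityˡ (+ n)
            | sym (ℤP.pos-* a (suc N)) | sym (ℤP.pos-* L (suc N)) | sym (ℤP.pos-+ (a * suc N) n)
            = ℤ.+≤+ cross-multipliedℕ

open RationalBound

margin-large : ∀ d k → 3 ≤ d → suc d * k ≤ suc (4 * k) * (d ∸ 2)
margin-large (suc zero)          k (s≤s ())
margin-large (suc (suc zero))    k (s≤s (s≤s ()))
margin-large (suc (suc (suc e))) k _ =
  subst (suc (suc (suc (suc e))) * k ≤_) (expand e k) (m≤m+n _ (3 * e * k + e + 1))
  where
  expand : ∀ e k → (4 + e) * k + (3 * e * k + e + 1) ≡ suc (4 * k) * suc e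
  expand = solve-∀

low-bound : ∀ p d → 2 ≤ d → p + d ∸ 1 ≡ suc p + (d ∸ 2)
low-bound p (suc zero)    (s≤s ())
low-bound p (suc (suc c)) _ = trans (cong (_∸ 1) (+-suc p (suc c))) (+-suc p c)

module Instance (k₀ m : ℕ) (k≥3 : 3 ≤ suc k₀) (large : 3 * suc k₀ ≤ suc m) where

  open import Data.Nat.DivMod using (_/_; m/n*n≤m; m≡m%n+[m/n]*n; m%n<n; m*n/n≡m; /-monoˡ-≤)

  k n d : ℕ
  k = suc k₀
  n = suc m
  d = n / k

  open Construction m d public using (G; bound; outdegSeq-bound; indegSeq-bound; cycle-through-0)

  d*k≤n : d * k ≤ n
  d*k≤n = m/n*n≤m n k

  n<[d+1]*k : n < suc d * k
  n<[d+1]*k = subst (_< k + d * k) (sym (m≡m%n+[m/n]*n n k)) (+-monoˡ-< (d * k) (m%n<n n k))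

  d≥3 : 3 ≤ d
  d≥3 = subst (_≤ d) (m*n/n≡m 3 k) (/-monoˡ-≤ k large)

  n≤[4k+1]*margin : n ≤ suc (4 * k) * (d ∸ 2)
  n≤[4k+1]*margin = ≤-trans (<⇒≤ n<[d+1]*k) (margin-large d k d≥3)

  -- a position p with 2 (p + 1) < n lies below the cap m of reach, even after adding d
  low-position : ∀ p → 2 * suc p < n → p + d ≤ m
  low-position p 2[p+1]<n = s≤s⁻¹ (<⇒≤ (*-cancelˡ-< 2 (suc p + d) n (begin-strict
    2 * (suc p + d)      ≡⟨ *-distribˡ-+ 2 (suc p) d ⟩
    2 * suc p + 2 * d    <⟨ +-monoˡ-< (2 * d) 2[p+1]<n ⟩
    n + 2 * d            ≤⟨ +-monoʳ-≤ n 2d≤n ⟩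
    n + n                ≡⟨ cong (n +_) (sym (+-identityʳ n)) ⟩
    2 * n                ∎)))
    where
    open ≤-Reasoning
    2d≤n : 2 * d ≤ n
    2d≤n = begin
      2 * d   ≡⟨ *-comm 2 d ⟩
      d * 2   ≤⟨ *-monoʳ-≤ d (≤-trans (n≤1+n 2) k≥3) ⟩
      d * k   ≤⟨ d*k≤n ⟩
      n       ∎

  degree-condition : (seq : List ℕ) → (∀ j → bound (toℕ j) ≤ lookup seq j) →
    ∀ (j : Fin (length seq)) → 2 * suc (toℕ j) < n →
    ℕ→ℚ (suc (toℕ j)) +ℚ η (4 * k) *ℚ ℕ→ℚ n ≤ℚ ℕ→ℚ (lookup seq j)
  degree-condition seq seq-bound j low =
    η-bound (4 * k) (suc p) n (d ∸ 2) (lookup seq j) n≤[4k+1]*margin entry-bound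
    where
    p : ℕ
    p = toℕ j
    bound-at-p : bound p ≡ suc p + (d ∸ 2)
    bound-at-p = trans (cong (_∸ 1) (m≤n⇒m⊓n≡m (low-position p low)))
                       (low-bound p d (≤-trans (n≤1+n 2) d≥3))
    entry-bound : suc p + (d ∸ 2) ≤ lookup seq j
    entry-bound = subst (_≤ lookup seq j) bound-at-p (seq-bound j)

  -- vertex 0 lies on no cycle of length ℓ < k, since such a cycle needs n ≤ ℓ · d < n
  no-short-cycle : ∀ ℓ → ℓ < k → ¬ DirectedCycleThrough G fzero ℓ
  no-short-cycle zero          _   C with DirectedCycleThrough.atLeast2 C
  ... | ()
  no-short-cycle (suc zero)    _   C with DirectedCycleThrough.atLeast2 C
  ... | s≤s ()
  no-short-cycle (suc (suc L)) ℓ<k C = <⇒≱ too-short (cycle-through-0 refl C)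
    where
    open ≤-Reasoning
    too-short : suc (suc L) * d < n
    too-short = begin-strict
      suc (suc L) * d          <⟨ m<n+m _ (≤-trans (s≤s z≤n) d≥3) ⟩
      d + suc (suc L) * d      ≤⟨ *-monoˡ-≤ d ℓ<k ⟩
      k * d                    ≡⟨ *-comm k d ⟩
      d * k                    ≤⟨ d*k≤n ⟩
      n                        ∎

proposition9 : ∀ (k : ℕ) → 3 ≤ k →
    Σ ℚ λ η → Positive η × Σ ℕ λ n₀ → ∀ (n : ℕ) → n₀ ≤ n →
      Σ (Digraph n) λ G →
        (∀ (j : Fin (length (outdegSeq G))) → 2 * suc (toℕ j) < n →
           ℕ→ℚ (suc (toℕ j)) +ℚ η *ℚ ℕ→ℚ n ≤ℚ ℕ→ℚ (lookup (outdegSeq G) j))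
        × (∀ (j : Fin (length (indegSeq G))) → 2 * suc (toℕ j) < n →
           ℕ→ℚ (suc (toℕ j)) +ℚ η *ℚ ℕ→ℚ n ≤ℚ ℕ→ℚ (lookup (indegSeq G) j))
        × ∃ λ (v : Fin n) → ∀ (ℓ : ℕ) → ℓ < k → ¬ DirectedCycleThrough G v ℓ
proposition9 (suc k₀) k≥3 = η (4 * suc k₀) , η-positive (4 * suc k₀) , 3 * suc k₀ , λ where
  (suc m) large → let open Instance k₀ m k≥3 large in
    G , degree-condition (outdegSeq G) outdegSeq-bound
      , degree-condition (indegSeq G) indegSeq-bound
      , fzero , no-short-cycle
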